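{- Let $\varrho$ be a substitution from a context $\Gamma$ to a context $\Delta$. Suppose that for every context $\Xi$ of fresh variables: (i) for all $a^A,b^B\in\{\Gamma\}$ with $A\equiv[A_1,\dots,A_n]$, $B\equiv[B_1,\dots,B_m]$ and all $M_i\in\Lambda^{\Xi,\Delta}(A_i)$, $N_i\in\Lambda^{\Xi,\Delta}(B_i)$: $\varrho_aM_1\cdots M_n=_{\beta\eta}\varrho_bN_1\cdots N_m$ implies $a=b$ and $M_i=N_i$ for all $i$; (ii) for all $a^A\in\{\Gamma\}$, $d^D\in\{\Xi\}$ with $A\equiv[A_1,\dots,A_n]$, $D\equiv[D_1,\dots,D_\ell]$ and all $M_i\in\Lambda^{\Xi,\Delta}(A_i)$, $N_i\in\Lambda^{\Xi,\Delta}(D_i)$: $\varrho_aM_1\cdots M_n\neq_{\beta\eta} d\,N_1\cdots N_\ell$. Then $\varrho$ is an atomic reduction.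
   Context: Simply typed $\lambda$-calculus over base type $0$; every type is uniquely $[A_1,\dots,A_n]:=A_1\to\cdots\to A_n\to0$. A context is a finite list of distinct typed variables, $\{\Gamma\}$ its set; terms identified up to $\beta\eta$ ($=_{\beta\eta}$); $\Lambda^\Xi(A)$ = terms of type $A$ with free variables in $\{\Xi\}$. A substitution $\varrho$ from $\Gamma$ to $\Delta$ assigns $\varrho_c\in\Lambda^\Delta(C)$ to each $c^C\in\{\Gamma\}$; for a fresh context $\Xi$, $\varrho^\Xi$ is $\varrho$ on $\{\Gamma\}$ and the identity on $\{\Xi\}$. $\varrho$ is an atomic reduction if for every fresh context $\Xi$, all $a^A,b^B\in\{\Xi,\Gamma\}$ with $A\equiv[A_1,\dots,A_n]$, $B\equiv[B_1,\dots,B_m]$, and all $M_i\in\Lambda^{\Xi,\Delta}(A_i)$, $N_i\in\Lambda^{\Xi,\Delta}(B_i)$: $\varrho^\Xi_aM_1\cdots M_n=_{\beta\eta}\varrho^\Xi_bN_1\cdots N_m$ implies $a=b$ and all $M_i=N_i$. -}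

module Defs where

open import Data.List using (List; []; _∷_; _++_)
open import Data.List.Relation.Unary.All using (All; []; _∷_)
open import Data.Product using (Σ; _×_; _,_)
open import Relation.Binary.PropositionalEquality using (_≡_; subst)
open import Relation.Nullary using (¬_)

-- Simple types over the base type 0: every type is uniquely
-- [A₁,…,Aₙ] := A₁ → ⋯ → Aₙ → 0, represented by the list of A's.

data Ty : Set where
  [_] : List Ty → Ty

O : Ty
O = [ [] ]

-- Contexts: lists of types (de Bruijn; variables are positions, hence
-- automatically distinct).  The head of the list is the most recent variable.
Ctx : Set
Ctx = List Ty

infix 4 _∋_
data _∋_ : Ctx → Ty → Set where
  here  : ∀ {Γ A} → (A ∷ Γ) ∋ A
  there : ∀ {Γ A B} → Γ ∋ A → (B ∷ Γ) ∋ A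

-- Intrinsically typed λ-terms:  Tm Γ A  is  Λ^Γ(A) before quotienting.
data Tm (Γ : Ctx) : Ty → Set where
  var : ∀ {A} → Γ ∋ A → Tm Γ A
  lam : ∀ {A Bs} → Tm (A ∷ Γ) [ Bs ] → Tm Γ [ A ∷ Bs ]
  app : ∀ {A Bs} → Tm Γ [ A ∷ Bs ] → Tm Γ A → Tm Γ [ Bs ]

Ren : Ctx → Ctx → Set
Ren Γ Δ = ∀ {A} → Γ ∋ A → Δ ∋ A

extR : ∀ {Γ Δ B} → Ren Γ Δ → Ren (B ∷ Γ) (B ∷ Δ)
extR r here      = here
extR r (there x) = there (r x)

rename : ∀ {Γ Δ A} → Ren Γ Δ → Tm Γ A → Tm Δ A
rename r (var x)   = var (r x)
rename r (lam M)   = lam (rename (extR r) M)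
rename r (app M N) = app (rename r M) (rename r N)

Sub : Ctx → Ctx → Set
Sub Γ Δ = ∀ {A} → Γ ∋ A → Tm Δ A

extS : ∀ {Γ Δ B} → Sub Γ Δ → Sub (B ∷ Γ) (B ∷ Δ)
extS s here      = var here
extS s (there x) = rename there (s x)

subst-tm : ∀ {Γ Δ A} → Sub Γ Δ → Tm Γ A → Tm Δ A
subst-tm s (var x)   = s x
subst-tm s (lam M)   = lam (subst-tm (extS s) M)
subst-tm s (app M N) = app (subst-tm s M) (subst-tm s N)

single : ∀ {Γ A} → Tm Γ A → Sub (A ∷ Γ) Γ
single N here      = N
single N (there x) = var x

infix 4 _=βη_
data _=βη_ {Γ : Ctx} : ∀ {A} → Tm Γ A → Tm Γ A → Set where
  refl′ : ∀ {A} {M : Tm Γ A} → M =βη M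
  sym′  : ∀ {A} {M N : Tm Γ A} → M =βη N → N =βη M
  trans′ : ∀ {A} {M N P : Tm Γ A} → M =βη N → N =βη P → M =βη P
  cong-lam : ∀ {A Bs} {M N : Tm (A ∷ Γ) [ Bs ]} → M =βη N → lam M =βη lam N
  cong-app : ∀ {A Bs} {M M′ : Tm Γ [ A ∷ Bs ]} {N N′ : Tm Γ A} →
             M =βη M′ → N =βη N′ → app M N =βη app M′ N′
  β : ∀ {A Bs} (M : Tm (A ∷ Γ) [ Bs ]) (N : Tm Γ A) →
      app (lam M) N =βη subst-tm (single N) M
  η : ∀ {A Bs} (M : Tm Γ [ A ∷ Bs ]) →
      M =βη lam (app (rename there M) (var here))

Args : Ctx → List Ty → Set
Args Γ As = All (Tm Γ) As

apps : ∀ {Γ As} → Tm Γ [ As ] → Args Γ As → Tm Γ O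
apps P []       = P
apps P (M ∷ Ms) = apps (app P M) Ms

data _≈Args_ {Γ : Ctx} : ∀ {As} → Args Γ As → Args Γ As → Set where
  []  : [] ≈Args []
  _∷_ : ∀ {A As} {M N : Tm Γ A} {Ms Ns : Args Γ As} →
        M =βη N → Ms ≈Args Ns → (M ∷ Ms) ≈Args (N ∷ Ns)

-- Context extension "Ξ,Δ" is Ξ ++ Δ (Ξ fresh, i.e. disjoint by construction).

inl : ∀ {Ξ Δ A} → Ξ ∋ A → (Ξ ++ Δ) ∋ A
inl here      = here
inl (there x) = there (inl x)

inr : ∀ Ξ {Δ A} → Δ ∋ A → (Ξ ++ Δ) ∋ A
inr []      x = x
inr (B ∷ Ξ) x = there (inr Ξ x)

-- ϱ viewed in Λ^{Ξ,Δ}: weakening of ϱ_c along Δ ⊆ Ξ,Δ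
wkΞ : ∀ Ξ {Δ A} → Tm Δ A → Tm (Ξ ++ Δ) A
wkΞ Ξ = rename (inr Ξ)

extΞ : ∀ Ξ {Γ Δ} → Sub Γ Δ → Sub (Ξ ++ Γ) (Ξ ++ Δ)
extΞ []      ρ x         = ρ x
extΞ (B ∷ Ξ) ρ here      = var here
extΞ (B ∷ Ξ) ρ (there x) = rename there (extΞ Ξ ρ x)

SameHeadArgs : ∀ {Θ Γ As Bs} → Θ ∋ [ As ] → Θ ∋ [ Bs ] →
               Args Γ As → Args Γ Bs → Set
SameHeadArgs {Θ} {Γ} {As} {Bs} a b Ms Ns =
  Σ (As ≡ Bs) λ p →
    (subst (λ Xs → Θ ∋ [ Xs ]) p a ≡ b) ×
    (subst (Args Γ) p Ms ≈Args Ns)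

IsAtomicReduction : ∀ {Γ Δ} → Sub Γ Δ → Set
IsAtomicReduction {Γ} {Δ} ρ =
  ∀ (Ξ : Ctx) {As Bs} (a : (Ξ ++ Γ) ∋ [ As ]) (b : (Ξ ++ Γ) ∋ [ Bs ])
    (Ms : Args (Ξ ++ Δ) As) (Ns : Args (Ξ ++ Δ) Bs) →
    apps (extΞ Ξ ρ a) Ms =βη apps (extΞ Ξ ρ b) Ns →
    SameHeadArgs a b Ms Ns

CondI : ∀ {Γ Δ} → Sub Γ Δ → Ctx → Set
CondI {Γ} {Δ} ρ Ξ =
  ∀ {As Bs} (a : Γ ∋ [ As ]) (b : Γ ∋ [ Bs ])
    (Ms : Args (Ξ ++ Δ) As) (Ns : Args (Ξ ++ Δ) Bs) →
    apps (wkΞ Ξ (ρ a)) Ms =βη apps (wkΞ Ξ (ρ b)) Ns →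
    SameHeadArgs a b Ms Ns

CondII : ∀ {Γ Δ} → Sub Γ Δ → Ctx → Set
CondII {Γ} {Δ} ρ Ξ =
  ∀ {As Ds} (a : Γ ∋ [ As ]) (d : Ξ ∋ [ Ds ])
    (Ms : Args (Ξ ++ Δ) As) (Ns : Args (Ξ ++ Δ) Ds) →
    ¬ (apps (wkΞ Ξ (ρ a)) Ms =βη apps (var (inl d)) Ns)

-- βη-equality is decided by η-long β-normal forms, computed by hereditary
-- substitution (nf M ≡ nf N whenever M =βη N, and M =βη nf M).  The normal
-- form of x M₁ ⋯ Mₙ is x applied to the normal forms of the Mᵢ, so
-- x M⃗ =βη y N⃗ forces x = y and M⃗ =βη N⃗.  For heads a, b of Ξ,Γ under ϱ^Ξ:
-- both in Γ is hypothesis (i), one in each is excluded by (ii), and both in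
-- Ξ is this injectivity of variable heads.  Soundness for β rests on the
-- substitution lemma for hereditary substitution, proved by induction on the
-- sizes of the two substituted types.
module Submission where

open import Defs
open import Data.Empty using (⊥-elim)
open import Data.List using (List; []; _∷_; _++_)
open import Data.List.Relation.Unary.All using ([]; _∷_)
open import Data.Nat using (ℕ; suc; _+_; _≤_; s≤s)
open import Data.Nat.Properties using (+-comm; +-monoˡ-≤; m≤m+n; m≤n+m; ≤-trans; ≤-refl)
open import Data.Product using (Σ; _×_; _,_; proj₁; proj₂)
open import Relation.Binary.PropositionalEquality hiding (cong-app)
open ≡-Reasoning

mutual
  data Nf (Γ : Ctx) : Ty → Set where
    lam : ∀ {A Bs} → Nf (A ∷ Γ) [ Bs ] → Nf Γ [ A ∷ Bs ]
    ne  : ∀ {As} → Γ ∋ [ As ] → Spine Γ As [] → Nf Γ O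

  -- Arguments taking a head of type [ As ] to one of type [ Bs ].
  data Spine (Γ : Ctx) : List Ty → List Ty → Set where
    done : ∀ {Bs} → Spine Γ Bs Bs
    _∷_  : ∀ {A As Bs} → Nf Γ A → Spine Γ As Bs → Spine Γ (A ∷ As) Bs

mutual
  renNf : ∀ {Γ Δ A} → Ren Γ Δ → Nf Γ A → Nf Δ A
  renNf r (lam b)   = lam (renNf (extR r) b)
  renNf r (ne x sp) = ne (r x) (renSp r sp)

  renSp : ∀ {Γ Δ As Bs} → Ren Γ Δ → Spine Γ As Bs → Spine Δ As Bs
  renSp r done     = done
  renSp r (s ∷ sp) = renNf r s ∷ renSp r sp

wkNf : ∀ {Γ A B} → Nf Γ A → Nf (B ∷ Γ) A
wkNf = renNf there

snoc : ∀ {Γ As B Bs} → Spine Γ As (B ∷ Bs) → Nf Γ B → Spine Γ As Bs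
snoc done     s = s ∷ done
snoc (t ∷ sp) s = t ∷ snoc sp s

_+++_ : ∀ {Γ As Bs Cs} → Spine Γ As Bs → Spine Γ Bs Cs → Spine Γ As Cs
done     +++ sp′ = sp′
(s ∷ sp) +++ sp′ = s ∷ (sp +++ sp′)

mutual
  emb : ∀ {Γ A} → Nf Γ A → Tm Γ A
  emb (lam b)   = lam (emb b)
  emb (ne x sp) = appSpine (var x) sp

  appSpine : ∀ {Γ As Bs} → Tm Γ [ As ] → Spine Γ As Bs → Tm Γ [ Bs ]
  appSpine M done     = M
  appSpine M (s ∷ sp) = appSpine (app M (emb s)) sp

Ren≗ : ∀ {Γ Δ} → Ren Γ Δ → Ren Γ Δ → Set
Ren≗ {Γ} r r′ = ∀ {A} (x : Γ ∋ A) → r x ≡ r′ x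

extR-cong : ∀ {Γ Δ B} {r r′ : Ren Γ Δ} → Ren≗ r r′ → Ren≗ (extR {B = B} r) (extR r′)
extR-cong h here      = refl
extR-cong h (there x) = cong there (h x)

extR-id : ∀ {Γ B} → Ren≗ (extR {Γ} {Γ} {B} (λ x → x)) (λ x → x)
extR-id here      = refl
extR-id (there x) = refl

extR-comp : ∀ {Γ Δ Θ B} (r : Ren Γ Δ) (r′ : Ren Δ Θ) →
  Ren≗ (λ x → extR {B = B} r′ (extR r x)) (extR (λ x → r′ (r x)))
extR-comp r r′ here      = refl
extR-comp r r′ (there x) = refl

rename-cong : ∀ {Γ Δ A} {r r′ : Ren Γ Δ} → Ren≗ r r′ → (M : Tm Γ A) → rename r M ≡ rename r′ M
rename-cong h (var x)   = cong var (h x)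
rename-cong h (lam M)   = cong lam (rename-cong (extR-cong h) M)
rename-cong h (app M N) = cong₂ app (rename-cong h M) (rename-cong h N)

rename-id : ∀ {Γ A} (M : Tm Γ A) → rename (λ x → x) M ≡ M
rename-id (var x)   = refl
rename-id (lam M)   = cong lam (trans (rename-cong extR-id M) (rename-id M))
rename-id (app M N) = cong₂ app (rename-id M) (rename-id N)

rename-comp : ∀ {Γ Δ Θ A} (r : Ren Γ Δ) (r′ : Ren Δ Θ) (M : Tm Γ A) →
  rename r′ (rename r M) ≡ rename (λ x → r′ (r x)) M
rename-comp r r′ (var x)   = refl
rename-comp r r′ (lam M)   =
  cong lam (trans (rename-comp (extR r) (extR r′) M) (rename-cong (extR-comp r r′) M))
rename-comp r r′ (app M N) = cong₂ app (rename-comp r r′ M) (rename-comp r r′ N)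

mutual
  renNf-cong : ∀ {Γ Δ A} {r r′ : Ren Γ Δ} → Ren≗ r r′ → (n : Nf Γ A) → renNf r n ≡ renNf r′ n
  renNf-cong h (lam b)   = cong lam (renNf-cong (extR-cong h) b)
  renNf-cong h (ne x sp) = cong₂ ne (h x) (renSp-cong h sp)

  renSp-cong : ∀ {Γ Δ As Bs} {r r′ : Ren Γ Δ} → Ren≗ r r′ →
    (sp : Spine Γ As Bs) → renSp r sp ≡ renSp r′ sp
  renSp-cong h done     = refl
  renSp-cong h (s ∷ sp) = cong₂ _∷_ (renNf-cong h s) (renSp-cong h sp)

mutual
  renNf-id : ∀ {Γ A} (n : Nf Γ A) → renNf (λ x → x) n ≡ n
  renNf-id (lam b)   = cong lam (trans (renNf-cong extR-id b) (renNf-id b))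
  renNf-id (ne x sp) = cong (ne x) (renSp-id sp)

  renSp-id : ∀ {Γ As Bs} (sp : Spine Γ As Bs) → renSp (λ x → x) sp ≡ sp
  renSp-id done     = refl
  renSp-id (s ∷ sp) = cong₂ _∷_ (renNf-id s) (renSp-id sp)

mutual
  renNf-comp : ∀ {Γ Δ Θ A} (r : Ren Γ Δ) (r′ : Ren Δ Θ) (n : Nf Γ A) →
    renNf r′ (renNf r n) ≡ renNf (λ x → r′ (r x)) n
  renNf-comp r r′ (lam b)   =
    cong lam (trans (renNf-comp (extR r) (extR r′) b) (renNf-cong (extR-comp r r′) b))
  renNf-comp r r′ (ne x sp) = cong (ne (r′ (r x))) (renSp-comp r r′ sp)

  renSp-comp : ∀ {Γ Δ Θ As Bs} (r : Ren Γ Δ) (r′ : Ren Δ Θ) (sp : Spine Γ As Bs) →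
    renSp r′ (renSp r sp) ≡ renSp (λ x → r′ (r x)) sp
  renSp-comp r r′ done     = refl
  renSp-comp r r′ (s ∷ sp) = cong₂ _∷_ (renNf-comp r r′ s) (renSp-comp r r′ sp)

renNf-extR-wkNf : ∀ {Γ Δ A B} (r : Ren Γ Δ) (n : Nf Γ A) →
  renNf (extR {B = B} r) (wkNf n) ≡ wkNf (renNf r n)
renNf-extR-wkNf r n = trans (renNf-comp there (extR r) n) (sym (renNf-comp r there n))

renSp-extR-wkSp : ∀ {Γ Δ As Bs B} (r : Ren Γ Δ) (sp : Spine Γ As Bs) →
  renSp (extR {B = B} r) (renSp there sp) ≡ renSp there (renSp r sp)
renSp-extR-wkSp r sp = trans (renSp-comp there (extR r) sp) (sym (renSp-comp r there sp))

renSp-snoc : ∀ {Γ Δ As B Bs} (r : Ren Γ Δ) (sp : Spine Γ As (B ∷ Bs)) (s : Nf Γ B) →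
  renSp r (snoc sp s) ≡ snoc (renSp r sp) (renNf r s)
renSp-snoc r done     s = refl
renSp-snoc r (t ∷ sp) s = cong (renNf r t ∷_) (renSp-snoc r sp s)

+++-identityʳ : ∀ {Γ As Bs} (sp : Spine Γ As Bs) → sp +++ done ≡ sp
+++-identityʳ done     = refl
+++-identityʳ (s ∷ sp) = cong (s ∷_) (+++-identityʳ sp)

snoc-+++ : ∀ {Γ As B Bs Cs} (sp : Spine Γ As (B ∷ Bs)) (s : Nf Γ B) (sp′ : Spine Γ Bs Cs) →
  snoc sp s +++ sp′ ≡ sp +++ (s ∷ sp′)
snoc-+++ done     s sp′ = refl
snoc-+++ (t ∷ sp) s sp′ = cong (t ∷_) (snoc-+++ sp s sp′)

-- Γ⁻ is Γ with one variable of type C removed.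
data Del : Ctx → Ty → Ctx → Set where
  hd : ∀ {C Γ} → Del (C ∷ Γ) C Γ
  tl : ∀ {B C Γ Γ⁻} → Del Γ C Γ⁻ → Del (B ∷ Γ) C (B ∷ Γ⁻)

deleted : ∀ {Γ C Γ⁻} → Del Γ C Γ⁻ → Γ ∋ C
deleted hd     = here
deleted (tl y) = there (deleted y)

skip : ∀ {Γ C Γ⁻} → Del Γ C Γ⁻ → Ren Γ⁻ Γ
skip hd     z         = there z
skip (tl y) here      = here
skip (tl y) (there z) = there (skip y z)

data View {Γ C Γ⁻} (y : Del Γ C Γ⁻) : ∀ {B} → Γ ∋ B → Set where
  same  : View y (deleted y)
  other : ∀ {B} (z : Γ⁻ ∋ B) → View y (skip y z)

view : ∀ {Γ C Γ⁻ B} (y : Del Γ C Γ⁻) (z : Γ ∋ B) → View y z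
view hd     here      = same
view hd     (there z) = other z
view (tl y) here      = other here
view (tl y) (there z) with view y z
... | same     = same
... | other z′ = other (there z′)

view-deleted : ∀ {Γ C Γ⁻} (y : Del Γ C Γ⁻) → view y (deleted y) ≡ same
view-deleted hd = refl
view-deleted (tl y) rewrite view-deleted y = refl

view-skip : ∀ {Γ C Γ⁻ B} (y : Del Γ C Γ⁻) (z : Γ⁻ ∋ B) → view y (skip y z) ≡ other z
view-skip hd     z = refl
view-skip (tl y) here = refl
view-skip (tl y) (there z) rewrite view-skip y z = refl

-- happ only calls hsub at the strictly smaller argument types of its head.
mutual
  hsub : ∀ {Γ C Γ⁻ A} → Del Γ C Γ⁻ → Nf Γ A → Nf Γ⁻ C → Nf Γ⁻ A
  hsub y (lam b)   u = lam (hsub (tl y) b (wkNf u))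
  hsub y (ne z sp) u with view y z
  ... | same     = happ u (hsubSp y sp u)
  ... | other z′ = ne z′ (hsubSp y sp u)

  hsubSp : ∀ {Γ C Γ⁻ As Bs} → Del Γ C Γ⁻ → Spine Γ As Bs → Nf Γ⁻ C → Spine Γ⁻ As Bs
  hsubSp y done     u = done
  hsubSp y (s ∷ sp) u = hsub y s u ∷ hsubSp y sp u

  happ : ∀ {Γ As Bs} → Nf Γ [ As ] → Spine Γ As Bs → Nf Γ [ Bs ]
  happ n       done     = n
  happ (lam b) (s ∷ sp) = happ (hsub hd b s) sp

happ₁ : ∀ {Γ A Bs} → Nf Γ [ A ∷ Bs ] → Nf Γ A → Nf Γ [ Bs ]
happ₁ (lam b) n = hsub hd b n

hsub-ne-deleted : ∀ {Γ Γ⁻ As} (y : Del Γ [ As ] Γ⁻) (sp : Spine Γ As []) (u : Nf Γ⁻ [ As ]) →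
  hsub y (ne (deleted y) sp) u ≡ happ u (hsubSp y sp u)
hsub-ne-deleted y sp u rewrite view-deleted y = refl

hsub-ne-skip : ∀ {Γ C Γ⁻ As} (y : Del Γ C Γ⁻) (z : Γ⁻ ∋ [ As ]) (sp : Spine Γ As []) (u : Nf Γ⁻ C) →
  hsub y (ne (skip y z) sp) u ≡ ne z (hsubSp y sp u)
hsub-ne-skip y z sp u rewrite view-skip y z = refl

mutual
  η-expand : ∀ {Γ As Bs} → Γ ∋ [ As ] → Spine Γ As Bs → Nf Γ [ Bs ]
  η-expand {Bs = []}     x sp = ne x sp
  η-expand {Bs = B ∷ Bs} x sp = lam (η-expand (there x) (extSp sp))

  extSp : ∀ {Γ As B Bs} → Spine Γ As (B ∷ Bs) → Spine (B ∷ Γ) As Bs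
  extSp sp = snoc (renSp there sp) (varNf here)

  varNf : ∀ {Γ A} → Γ ∋ A → Nf Γ A
  varNf {A = [ As ]} x = η-expand x done

nf : ∀ {Γ A} → Tm Γ A → Nf Γ A
nf (var x)   = varNf x
nf (lam M)   = lam (nf M)
nf (app M N) = happ₁ (nf M) (nf N)

record Restricts {Γ Δ C Γ⁻ Δ⁻} (y : Del Γ C Γ⁻) (y′ : Del Δ C Δ⁻)
                 (r⁺ : Ren Γ Δ) (r : Ren Γ⁻ Δ⁻) : Set where
  constructor restricts
  field
    deleted-restricts : r⁺ (deleted y) ≡ deleted y′
    skip-restricts    : ∀ {B} (z : Γ⁻ ∋ B) → r⁺ (skip y z) ≡ skip y′ (r z)
open Restricts

restricts-hd : ∀ {Γ Δ C} (r : Ren Γ Δ) → Restricts (hd {C = C}) hd (extR r) r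
restricts-hd r = restricts refl (λ z → refl)

restricts-tl : ∀ {Γ Δ C Γ⁻ Δ⁻ B} {y : Del Γ C Γ⁻} {y′ : Del Δ C Δ⁻} {r⁺ : Ren Γ Δ} {r : Ren Γ⁻ Δ⁻} →
  Restricts y y′ r⁺ r → Restricts (tl {B = B} y) (tl y′) (extR r⁺) (extR r)
restricts-tl (restricts d s) = restricts (cong there d) λ { here → refl ; (there z) → cong there (s z) }

restricts-there : ∀ {Γ C Γ⁻ B} (y : Del Γ C Γ⁻) → Restricts y (tl {B = B} y) there there
restricts-there y = restricts refl (λ z → refl)

mutual
  renNf-hsub : ∀ {Γ Δ C Γ⁻ Δ⁻ A} {y : Del Γ C Γ⁻} {y′ : Del Δ C Δ⁻} {r⁺ : Ren Γ Δ} {r : Ren Γ⁻ Δ⁻} →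
    Restricts y y′ r⁺ r → (b : Nf Γ A) (u : Nf Γ⁻ C) →
    renNf r (hsub y b u) ≡ hsub y′ (renNf r⁺ b) (renNf r u)
  renNf-hsub {y′ = y′} {r⁺} {r} h (lam b) u =
    cong lam (trans (renNf-hsub (restricts-tl h) b (wkNf u))
                    (cong (hsub (tl y′) (renNf (extR r⁺) b)) (renNf-extR-wkNf r u)))
  renNf-hsub {y = y} {y′} {r⁺} {r} h (ne z sp) u with view y z
  ... | same = begin
    renNf r (happ u (hsubSp y sp u))
      ≡⟨ renNf-happ r u (hsubSp y sp u) ⟩
    happ (renNf r u) (renSp r (hsubSp y sp u))
      ≡⟨ cong (happ (renNf r u)) (renSp-hsubSp h sp u) ⟩
    happ (renNf r u) (hsubSp y′ (renSp r⁺ sp) (renNf r u))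
      ≡⟨ sym (hsub-ne-deleted y′ (renSp r⁺ sp) (renNf r u)) ⟩
    hsub y′ (ne (deleted y′) (renSp r⁺ sp)) (renNf r u)
      ≡⟨ cong (λ w → hsub y′ (ne w (renSp r⁺ sp)) (renNf r u)) (sym (deleted-restricts h)) ⟩
    hsub y′ (ne (r⁺ (deleted y)) (renSp r⁺ sp)) (renNf r u)
      ∎
  ... | other z′ = begin
    ne (r z′) (renSp r (hsubSp y sp u))
      ≡⟨ cong (ne (r z′)) (renSp-hsubSp h sp u) ⟩
    ne (r z′) (hsubSp y′ (renSp r⁺ sp) (renNf r u))
      ≡⟨ sym (hsub-ne-skip y′ (r z′) (renSp r⁺ sp) (renNf r u)) ⟩
    hsub y′ (ne (skip y′ (r z′)) (renSp r⁺ sp)) (renNf r u)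
      ≡⟨ cong (λ w → hsub y′ (ne w (renSp r⁺ sp)) (renNf r u)) (sym (skip-restricts h z′)) ⟩
    hsub y′ (ne (r⁺ (skip y z′)) (renSp r⁺ sp)) (renNf r u)
      ∎

  renSp-hsubSp : ∀ {Γ Δ C Γ⁻ Δ⁻ As Bs} {y : Del Γ C Γ⁻} {y′ : Del Δ C Δ⁻} {r⁺ : Ren Γ Δ} {r : Ren Γ⁻ Δ⁻} →
    Restricts y y′ r⁺ r → (sp : Spine Γ As Bs) (u : Nf Γ⁻ C) →
    renSp r (hsubSp y sp u) ≡ hsubSp y′ (renSp r⁺ sp) (renNf r u)
  renSp-hsubSp h done     u = refl
  renSp-hsubSp h (s ∷ sp) u = cong₂ _∷_ (renNf-hsub h s u) (renSp-hsubSp h sp u)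

  renNf-happ : ∀ {Γ Δ As Bs} (r : Ren Γ Δ) (v : Nf Γ [ As ]) (sp : Spine Γ As Bs) →
    renNf r (happ v sp) ≡ happ (renNf r v) (renSp r sp)
  renNf-happ r v       done     = refl
  renNf-happ r (lam b) (s ∷ sp) = trans (renNf-happ r (hsub hd b s) sp)
    (cong (λ w → happ w (renSp r sp)) (renNf-hsub (restricts-hd r) b s))

mutual
  renNf-η-expand : ∀ {Γ Δ As Bs} (r : Ren Γ Δ) (x : Γ ∋ [ As ]) (sp : Spine Γ As Bs) →
    renNf r (η-expand x sp) ≡ η-expand (r x) (renSp r sp)
  renNf-η-expand {Bs = []}     r x sp = refl
  renNf-η-expand {Bs = B ∷ Bs} r x sp = cong lam (trans
    (renNf-η-expand (extR r) (there x) (extSp sp))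
    (cong (η-expand (there (r x))) (renSp-extSp r sp)))

  renSp-extSp : ∀ {Γ Δ As B Bs} (r : Ren Γ Δ) (sp : Spine Γ As (B ∷ Bs)) →
    renSp (extR r) (extSp sp) ≡ extSp (renSp r sp)
  renSp-extSp r sp = trans (renSp-snoc (extR r) (renSp there sp) (varNf here))
    (cong₂ snoc (renSp-extR-wkSp r sp) (renNf-varNf (extR r) here))

  renNf-varNf : ∀ {Γ Δ A} (r : Ren Γ Δ) (x : Γ ∋ A) → renNf r (varNf x) ≡ varNf (r x)
  renNf-varNf {A = [ As ]} r x = renNf-η-expand r x done

mutual
  hsub-renNf : ∀ {Γ Δ C Δ⁻ A} (y : Del Δ C Δ⁻) (r : Ren Γ Δ) (r′ : Ren Γ Δ⁻) →
    Ren≗ r (λ x → skip y (r′ x)) →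
    (b : Nf Γ A) (u : Nf Δ⁻ C) → hsub y (renNf r b) u ≡ renNf r′ b
  hsub-renNf y r r′ h (lam b) u = cong lam (hsub-renNf (tl y) (extR r) (extR r′)
    (λ { here → refl ; (there x) → cong there (h x) }) b (wkNf u))
  hsub-renNf y r r′ h (ne x sp) u = begin
    hsub y (ne (r x) (renSp r sp)) u            ≡⟨ cong (λ w → hsub y (ne w (renSp r sp)) u) (h x) ⟩
    hsub y (ne (skip y (r′ x)) (renSp r sp)) u  ≡⟨ hsub-ne-skip y (r′ x) (renSp r sp) u ⟩
    ne (r′ x) (hsubSp y (renSp r sp) u)         ≡⟨ cong (ne (r′ x)) (hsubSp-renSp y r r′ h sp u) ⟩
    ne (r′ x) (renSp r′ sp)                     ∎

  hsubSp-renSp : ∀ {Γ Δ C Δ⁻ As Bs} (y : Del Δ C Δ⁻) (r : Ren Γ Δ) (r′ : Ren Γ Δ⁻) →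
    Ren≗ r (λ x → skip y (r′ x)) →
    (sp : Spine Γ As Bs) (u : Nf Δ⁻ C) → hsubSp y (renSp r sp) u ≡ renSp r′ sp
  hsubSp-renSp y r r′ h done     u = refl
  hsubSp-renSp y r r′ h (s ∷ sp) u = cong₂ _∷_ (hsub-renNf y r r′ h s u) (hsubSp-renSp y r r′ h sp u)

hsub-skip : ∀ {Γ C Γ⁻ A} (y : Del Γ C Γ⁻) (u : Nf Γ⁻ A) (v : Nf Γ⁻ C) → hsub y (renNf (skip y) u) v ≡ u
hsub-skip y u v = trans (hsub-renNf y (skip y) (λ x → x) (λ x → refl) u v) (renNf-id u)

hsubSp-wkSp : ∀ {Γ C As Bs} (sp : Spine Γ As Bs) (v : Nf Γ C) → hsubSp hd (renSp there sp) v ≡ sp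
hsubSp-wkSp sp v = trans (hsubSp-renSp hd there (λ x → x) (λ x → refl) sp v) (renSp-id sp)

hsubSp-snoc : ∀ {Γ C Γ⁻ As B Bs} (y : Del Γ C Γ⁻) (sp : Spine Γ As (B ∷ Bs)) (s : Nf Γ B) (u : Nf Γ⁻ C) →
  hsubSp y (snoc sp s) u ≡ snoc (hsubSp y sp u) (hsub y s u)
hsubSp-snoc y done     s u = refl
hsubSp-snoc y (t ∷ sp) s u = cong (hsub y t u ∷_) (hsubSp-snoc y sp s u)

data Redirects {Δ Δ⁻ A} (y : Del Δ A Δ⁻) (w : Δ⁻ ∋ A) : ∀ {B} → Δ ∋ B → Δ⁻ ∋ B → Set where
  keep : ∀ {B} (z : Δ⁻ ∋ B) → Redirects y w (skip y z) z
  hit  : Redirects y w (deleted y) w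

redirects-tl : ∀ {Δ Δ⁻ A B D} {y : Del Δ A Δ⁻} {w : Δ⁻ ∋ A} {a : Δ ∋ B} {b : Δ⁻ ∋ B} →
  Redirects y w a b → Redirects (tl {B = D} y) (there w) (there a) (there b)
redirects-tl (keep z) = keep (there z)
redirects-tl hit      = hit

mutual
  hsub-η-expand-skip : ∀ {Γ C Γ⁻ As Bs} (y : Del Γ C Γ⁻) (z : Γ⁻ ∋ [ As ]) (sp : Spine Γ As Bs) (u : Nf Γ⁻ C) →
    hsub y (η-expand (skip y z) sp) u ≡ η-expand z (hsubSp y sp u)
  hsub-η-expand-skip {Bs = []}     y z sp u = hsub-ne-skip y z sp u
  hsub-η-expand-skip {Bs = B ∷ Bs} y z sp u = cong lam (trans
    (hsub-η-expand-skip (tl y) (there z) (extSp sp) (wkNf u))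
    (cong (η-expand (there z)) (hsubSp-extSp y sp u)))

  hsub-η-expand-deleted : ∀ {Γ As Γ⁻ Bs} (y : Del Γ [ As ] Γ⁻) (sp : Spine Γ As Bs) (u : Nf Γ⁻ [ As ]) →
    hsub y (η-expand (deleted y) sp) u ≡ happ u (hsubSp y sp u)
  hsub-η-expand-deleted {Bs = []}     y sp u = hsub-ne-deleted y sp u
  hsub-η-expand-deleted {Bs = B ∷ Bs} y sp u = trans (cong lam (trans
    (hsub-η-expand-deleted (tl y) (extSp sp) (wkNf u))
    (cong (happ (wkNf u)) (hsubSp-extSp y sp u)))) (η-happ u (hsubSp y sp u))

  hsub-varNf-skip : ∀ {Γ C Γ⁻ A} (y : Del Γ C Γ⁻) (z : Γ⁻ ∋ A) (u : Nf Γ⁻ C) →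
    hsub y (varNf (skip y z)) u ≡ varNf z
  hsub-varNf-skip {A = [ As ]} y z u = hsub-η-expand-skip y z done u

  hsub-varNf-deleted : ∀ {Γ C Γ⁻} (y : Del Γ C Γ⁻) (u : Nf Γ⁻ C) → hsub y (varNf (deleted y)) u ≡ u
  hsub-varNf-deleted {C = [ As ]} y u = hsub-η-expand-deleted y done u

  hsubSp-extSp : ∀ {Γ C Γ⁻ As B Bs} (y : Del Γ C Γ⁻) (sp : Spine Γ As (B ∷ Bs)) (u : Nf Γ⁻ C) →
    hsubSp (tl y) (extSp sp) (wkNf u) ≡ extSp (hsubSp y sp u)
  hsubSp-extSp y sp u = trans (hsubSp-snoc (tl y) (renSp there sp) (varNf here) (wkNf u))
    (cong₂ snoc (sym (renSp-hsubSp (restricts-there y) sp u)) (hsub-varNf-skip (tl y) here (wkNf u)))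

  hsubSp-hd-extSp : ∀ {Γ As B Bs} (sp : Spine Γ As (B ∷ Bs)) (s : Nf Γ B) →
    hsubSp hd (extSp sp) s ≡ snoc sp s
  hsubSp-hd-extSp sp s = trans (hsubSp-snoc hd (renSp there sp) (varNf here) s)
    (cong₂ snoc (hsubSp-wkSp sp s) (hsub-varNf-deleted hd s))

  η-happ : ∀ {Γ As B Bs} (v : Nf Γ [ As ]) (sp : Spine Γ As (B ∷ Bs)) →
    lam (happ (wkNf v) (extSp sp)) ≡ happ v sp
  η-happ (lam b) done     = cong lam (hsub-η-contract b)
  η-happ (lam b) (s ∷ sp) = trans
    (cong (λ t → lam (happ t (extSp sp))) (sym (renNf-hsub (restricts-hd there) b s)))
    (η-happ (hsub hd b s) sp)

  hsub-η-contract : ∀ {Γ A T} (b : Nf (A ∷ Γ) T) → hsub hd (renNf (extR there) b) (varNf here) ≡ b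
  hsub-η-contract b = trans
    (hsub-varNf-renNf hd here (extR there) (λ x → x) (λ { here → hit ; (there z) → keep (there z) }) b)
    (renNf-id b)

  hsub-varNf-renNf : ∀ {Γ Δ A Δ⁻ T} (y : Del Δ A Δ⁻) (w : Δ⁻ ∋ A) (r : Ren Γ Δ) (r′ : Ren Γ Δ⁻) →
    (∀ {B} (x : Γ ∋ B) → Redirects y w (r x) (r′ x)) →
    (b : Nf Γ T) → hsub y (renNf r b) (varNf w) ≡ renNf r′ b
  hsub-varNf-renNf y w r r′ H (lam b) = cong lam (trans
    (cong (hsub (tl y) (renNf (extR r) b)) (renNf-varNf there w))
    (hsub-varNf-renNf (tl y) (there w) (extR r) (extR r′)
      (λ { here → keep here ; (there x) → redirects-tl (H x) }) b))
  hsub-varNf-renNf y w r r′ H (ne x sp) with r x | r′ x | H x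
  ... | .(skip y z) | z | keep .z = trans (hsub-ne-skip y z (renSp r sp) (varNf w))
         (cong (ne z) (hsubSp-varNf-renSp y w r r′ H sp))
  ... | .(deleted y) | .w | hit = trans (hsub-ne-deleted y (renSp r sp) (varNf w))
         (trans (happ-η-expand w done (hsubSp y (renSp r sp) (varNf w)))
                (cong (ne w) (hsubSp-varNf-renSp y w r r′ H sp)))

  hsubSp-varNf-renSp : ∀ {Γ Δ A Δ⁻ As Bs} (y : Del Δ A Δ⁻) (w : Δ⁻ ∋ A) (r : Ren Γ Δ) (r′ : Ren Γ Δ⁻) →
    (∀ {B} (x : Γ ∋ B) → Redirects y w (r x) (r′ x)) →
    (sp : Spine Γ As Bs) → hsubSp y (renSp r sp) (varNf w) ≡ renSp r′ sp
  hsubSp-varNf-renSp y w r r′ H done     = refl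
  hsubSp-varNf-renSp y w r r′ H (s ∷ sp) =
    cong₂ _∷_ (hsub-varNf-renNf y w r r′ H s) (hsubSp-varNf-renSp y w r r′ H sp)

  happ-η-expand : ∀ {Γ As Bs Cs} (x : Γ ∋ [ As ]) (sp : Spine Γ As Bs) (sp′ : Spine Γ Bs Cs) →
    happ (η-expand x sp) sp′ ≡ η-expand x (sp +++ sp′)
  happ-η-expand x sp done = cong (η-expand x) (sym (+++-identityʳ sp))
  happ-η-expand {Bs = B ∷ Bs} x sp (s ∷ sp′) = begin
    happ (hsub hd (η-expand (there x) (extSp sp)) s) sp′
      ≡⟨ cong (λ t → happ t sp′) (hsub-η-expand-skip hd x (extSp sp) s) ⟩
    happ (η-expand x (hsubSp hd (extSp sp) s)) sp′
      ≡⟨ cong (λ t → happ (η-expand x t) sp′) (hsubSp-hd-extSp sp s) ⟩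
    happ (η-expand x (snoc sp s)) sp′
      ≡⟨ happ-η-expand x (snoc sp s) sp′ ⟩
    η-expand x (snoc sp s +++ sp′)
      ≡⟨ cong (η-expand x) (snoc-+++ sp s sp′) ⟩
    η-expand x (sp +++ (s ∷ sp′))
      ∎

mutual
  size : Ty → ℕ
  size [ As ] = suc (sizeL As)

  sizeL : List Ty → ℕ
  sizeL []       = 0
  sizeL (A ∷ As) = size A + sizeL As

-- Deleting y and then x removes the same two variables as deleting x′ and then y′.
data Swap : ∀ {Δ A Δ₁ C Δ₂ Δ₃} → Del Δ A Δ₁ → Del Δ₁ C Δ₂ → Del Δ C Δ₃ → Del Δ₃ A Δ₂ → Set where
  hd-x  : ∀ {A Δ₁ C Δ₂} {x : Del Δ₁ C Δ₂} → Swap (hd {C = A}) x (tl x) hd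
  tl-hd : ∀ {B Δ A Δ₁} {y : Del Δ A Δ₁} → Swap (tl {B = B} y) hd hd y
  tl-tl : ∀ {B Δ A Δ₁ C Δ₂ Δ₃} {y : Del Δ A Δ₁} {x : Del Δ₁ C Δ₂} {x′ : Del Δ C Δ₃} {y′ : Del Δ₃ A Δ₂} →
          Swap y x x′ y′ → Swap (tl {B = B} y) (tl x) (tl x′) (tl y′)

deleted-swap : ∀ {Δ A Δ₁ C Δ₂ Δ₃} {y : Del Δ A Δ₁} {x : Del Δ₁ C Δ₂} {x′ : Del Δ C Δ₃} {y′ : Del Δ₃ A Δ₂} →
  Swap y x x′ y′ → deleted y ≡ skip x′ (deleted y′)
deleted-swap hd-x       = refl
deleted-swap tl-hd      = refl
deleted-swap (tl-tl sw) = cong there (deleted-swap sw)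

skip-deleted-swap : ∀ {Δ A Δ₁ C Δ₂ Δ₃} {y : Del Δ A Δ₁} {x : Del Δ₁ C Δ₂} {x′ : Del Δ C Δ₃} {y′ : Del Δ₃ A Δ₂} →
  Swap y x x′ y′ → skip y (deleted x) ≡ deleted x′
skip-deleted-swap hd-x       = refl
skip-deleted-swap tl-hd      = refl
skip-deleted-swap (tl-tl sw) = cong there (skip-deleted-swap sw)

skip-skip-swap : ∀ {Δ A Δ₁ C Δ₂ Δ₃} {y : Del Δ A Δ₁} {x : Del Δ₁ C Δ₂} {x′ : Del Δ C Δ₃} {y′ : Del Δ₃ A Δ₂} →
  Swap y x x′ y′ → ∀ {B} (w : Δ₂ ∋ B) → skip y (skip x w) ≡ skip x′ (skip y′ w)
skip-skip-swap hd-x       w         = refl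
skip-skip-swap tl-hd      w         = refl
skip-skip-swap (tl-tl sw) here      = refl
skip-skip-swap (tl-tl sw) (there w) = cong there (skip-skip-swap sw w)

renNf-skip-wkNf : ∀ {Δ A Δ⁻ B C} (y : Del Δ A Δ⁻) (u : Nf Δ⁻ C) →
  renNf (skip (tl {B = B} y)) (wkNf u) ≡ wkNf (renNf (skip y) u)
renNf-skip-wkNf y u = trans (renNf-comp there (skip (tl y)) u) (sym (renNf-comp (skip y) there u))

-- k bounds size A + size C; it drops only when happ passes to the argument types.
mutual
  hsub-hsub : ∀ (k : ℕ) {Δ A Δ₁ C Δ₂ Δ₃ T} {y : Del Δ A Δ₁} {x : Del Δ₁ C Δ₂} {x′ : Del Δ C Δ₃} {y′ : Del Δ₃ A Δ₂} →
    Swap y x x′ y′ → size A + size C ≤ k →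
    (b : Nf Δ T) (n : Nf Δ₁ A) (u : Nf Δ₂ C) →
    hsub x (hsub y b n) u ≡ hsub y′ (hsub x′ b (renNf (skip y′) u)) (hsub x n u)
  hsub-hsub k {x = x} {x′} {y′} sw bnd (lam b) n u = cong lam (trans
    (hsub-hsub k (tl-tl sw) bnd b (wkNf n) (wkNf u))
    (cong₂ (λ p q → hsub (tl y′) (hsub (tl x′) b p) q)
           (renNf-skip-wkNf y′ u) (sym (renNf-hsub (restricts-there x) n u))))
  hsub-hsub k {A = A} {C = C} {y = y} {x} {x′} {y′} sw bnd (ne z sp) n u with view y z
  ... | same = begin
    hsub x (happ n (hsubSp y sp n)) u
      ≡⟨ hsub-happ k bnd x n (hsubSp y sp n) u ⟩
    happ v (hsubSp x (hsubSp y sp n) u)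
      ≡⟨ cong (happ v) (hsubSp-hsub k sw bnd sp n u) ⟩
    happ v (hsubSp y′ sp′ v)
      ≡⟨ sym (hsub-ne-deleted y′ sp′ v) ⟩
    hsub y′ (ne (deleted y′) sp′) v
      ≡⟨ cong (λ t → hsub y′ t v) (sym (hsub-ne-skip x′ (deleted y′) sp u′)) ⟩
    hsub y′ (hsub x′ (ne (skip x′ (deleted y′)) sp) u′) v
      ≡⟨ cong (λ t → hsub y′ (hsub x′ (ne t sp) u′) v) (sym (deleted-swap sw)) ⟩
    hsub y′ (hsub x′ (ne (deleted y) sp) u′) v
      ∎
    where u′ = renNf (skip y′) u
          v = hsub x n u
          sp′ = hsubSp x′ sp u′
  ... | other z₁ with view x z₁
  ...   | same = begin
    happ u (hsubSp x (hsubSp y sp n) u)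
      ≡⟨ cong (happ u) (hsubSp-hsub k sw bnd sp n u) ⟩
    happ u (hsubSp y′ sp′ v)
      ≡⟨ cong (λ t → happ t (hsubSp y′ sp′ v)) (sym (hsub-skip y′ u v)) ⟩
    happ (hsub y′ u′ v) (hsubSp y′ sp′ v)
      ≡⟨ sym (hsub-happ k (subst (_≤ k) (+-comm (size A) (size C)) bnd) y′ u′ sp′ v) ⟩
    hsub y′ (happ u′ sp′) v
      ≡⟨ cong (λ t → hsub y′ t v) (sym (hsub-ne-deleted x′ sp u′)) ⟩
    hsub y′ (hsub x′ (ne (deleted x′) sp) u′) v
      ≡⟨ cong (λ t → hsub y′ (hsub x′ (ne t sp) u′) v) (sym (skip-deleted-swap sw)) ⟩
    hsub y′ (hsub x′ (ne (skip y (deleted x)) sp) u′) v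
      ∎
    where u′ = renNf (skip y′) u
          v = hsub x n u
          sp′ = hsubSp x′ sp u′
  ...   | other w = begin
    ne w (hsubSp x (hsubSp y sp n) u)
      ≡⟨ cong (ne w) (hsubSp-hsub k sw bnd sp n u) ⟩
    ne w (hsubSp y′ sp′ v)
      ≡⟨ sym (hsub-ne-skip y′ w sp′ v) ⟩
    hsub y′ (ne (skip y′ w) sp′) v
      ≡⟨ cong (λ t → hsub y′ t v) (sym (hsub-ne-skip x′ (skip y′ w) sp u′)) ⟩
    hsub y′ (hsub x′ (ne (skip x′ (skip y′ w)) sp) u′) v
      ≡⟨ cong (λ t → hsub y′ (hsub x′ (ne t sp) u′) v) (sym (skip-skip-swap sw w)) ⟩
    hsub y′ (hsub x′ (ne (skip y (skip x w)) sp) u′) v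
      ∎
    where u′ = renNf (skip y′) u
          v = hsub x n u
          sp′ = hsubSp x′ sp u′

  hsubSp-hsub : ∀ (k : ℕ) {Δ A Δ₁ C Δ₂ Δ₃ As Bs} {y : Del Δ A Δ₁} {x : Del Δ₁ C Δ₂} {x′ : Del Δ C Δ₃} {y′ : Del Δ₃ A Δ₂} →
    Swap y x x′ y′ → size A + size C ≤ k →
    (sp : Spine Δ As Bs) (n : Nf Δ₁ A) (u : Nf Δ₂ C) →
    hsubSp x (hsubSp y sp n) u ≡ hsubSp y′ (hsubSp x′ sp (renNf (skip y′) u)) (hsub x n u)
  hsubSp-hsub k sw bnd done     n u = refl
  hsubSp-hsub k sw bnd (t ∷ sp) n u = cong₂ _∷_ (hsub-hsub k sw bnd t n u) (hsubSp-hsub k sw bnd sp n u)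

  hsub-happ : ∀ (k : ℕ) {Γ C Γ⁻ As Bs} → size [ As ] + size C ≤ k →
    (x : Del Γ C Γ⁻) (m : Nf Γ [ As ]) (sp : Spine Γ As Bs) (u : Nf Γ⁻ C) →
    hsub x (happ m sp) u ≡ happ (hsub x m u) (hsubSp x sp u)
  hsub-happ k bnd x m done u = refl
  hsub-happ (suc k) {C = C} {As = A ∷ As} (s≤s bnd) x (lam b) (s ∷ sp) u = trans
    (hsub-happ (suc k) (s≤s (≤-trans (+-monoˡ-≤ (size C) (m≤n+m (sizeL As) (size A))) bnd)) x (hsub hd b s) sp u)
    (cong (λ t → happ t (hsubSp x sp u))
      (hsub-hsub k hd-x (≤-trans (+-monoˡ-≤ (size C) (m≤m+n (size A) (sizeL As))) bnd) b s u))

nf-rename : ∀ {Γ Δ A} (r : Ren Γ Δ) (M : Tm Γ A) → nf (rename r M) ≡ renNf r (nf M)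
nf-rename r (var x)   = sym (renNf-varNf r x)
nf-rename r (lam M)   = cong lam (nf-rename (extR r) M)
nf-rename r (app M N) = trans (cong₂ happ₁ (nf-rename r M) (nf-rename r N)) (renNf-happ₁ (nf M) (nf N))
  where
  renNf-happ₁ : ∀ {A Bs} (m : Nf _ [ A ∷ Bs ]) (n : Nf _ A) → happ₁ (renNf r m) (renNf r n) ≡ renNf r (happ₁ m n)
  renNf-happ₁ (lam b) n = sym (renNf-hsub (restricts-hd r) b n)

nf-subst-tm : ∀ {Γ C Γ⁻ A} (y : Del Γ C Γ⁻) (σ : Sub Γ Γ⁻) (u : Nf Γ⁻ C) →
  (∀ {B} (x : Γ ∋ B) → nf (σ x) ≡ hsub y (varNf x) u) →
  (M : Tm Γ A) → nf (subst-tm σ M) ≡ hsub y (nf M) u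
nf-subst-tm y σ u H (var x)   = H x
nf-subst-tm y σ u H (lam M)   = cong lam (nf-subst-tm (tl y) (extS σ) (wkNf u) H′ M)
  where
  H′ : ∀ {B} (x : _ ∋ B) → nf (extS σ x) ≡ hsub (tl y) (varNf x) (wkNf u)
  H′ here      = sym (hsub-varNf-skip (tl y) here (wkNf u))
  H′ (there x) = begin
    nf (rename there (σ x))                          ≡⟨ nf-rename there (σ x) ⟩
    wkNf (nf (σ x))                                  ≡⟨ cong wkNf (H x) ⟩
    wkNf (hsub y (varNf x) u)                        ≡⟨ renNf-hsub (restricts-there y) (varNf x) u ⟩
    hsub (tl y) (wkNf (varNf x)) (wkNf u)            ≡⟨ cong (λ t → hsub (tl y) t (wkNf u)) (renNf-varNf there x) ⟩
    hsub (tl y) (varNf (there x)) (wkNf u)           ∎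
nf-subst-tm {C = C} y σ u H (app M N) =
  trans (cong₂ happ₁ (nf-subst-tm y σ u H M) (nf-subst-tm y σ u H N)) (hsub-happ₁ (nf M) (nf N))
  where
  hsub-happ₁ : ∀ {A Bs} (m : Nf _ [ A ∷ Bs ]) (n : Nf _ A) → happ₁ (hsub y m u) (hsub y n u) ≡ hsub y (happ₁ m n) u
  hsub-happ₁ {A} (lam b) n = sym (hsub-hsub (size A + size C) hd-x ≤-refl b n u)

nf-sound : ∀ {Γ A} {M N : Tm Γ A} → M =βη N → nf M ≡ nf N
nf-sound refl′          = refl
nf-sound (sym′ e)       = sym (nf-sound e)
nf-sound (trans′ e e′)  = trans (nf-sound e) (nf-sound e′)
nf-sound (cong-lam e)   = cong lam (nf-sound e)
nf-sound (cong-app e e′) = cong₂ happ₁ (nf-sound e) (nf-sound e′)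
nf-sound (β M N) = sym (nf-subst-tm hd (single N) (nf N) H M)
  where
  H : ∀ {B} (x : _ ∋ B) → nf (single N x) ≡ hsub hd (varNf x) (nf N)
  H here      = sym (hsub-varNf-deleted hd (nf N))
  H (there x) = sym (hsub-varNf-skip hd x (nf N))
nf-sound (η M) = trans (η-nf (nf M)) (cong (λ t → lam (happ₁ t (varNf here))) (sym (nf-rename there M)))
  where
  η-nf : ∀ {Γ A Bs} (m : Nf Γ [ A ∷ Bs ]) → m ≡ lam (happ₁ (wkNf m) (varNf here))
  η-nf (lam b) = cong lam (sym (hsub-η-contract b))

≡→=βη : ∀ {Γ A} {M N : Tm Γ A} → M ≡ N → M =βη N
≡→=βη refl = refl′

mutual
  emb-renNf : ∀ {Γ Δ A} (r : Ren Γ Δ) (n : Nf Γ A) → emb (renNf r n) ≡ rename r (emb n)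
  emb-renNf r (lam b)   = cong lam (emb-renNf (extR r) b)
  emb-renNf r (ne x sp) = sym (rename-appSpine r (var x) sp)

  rename-appSpine : ∀ {Γ Δ As Bs} (r : Ren Γ Δ) (M : Tm Γ [ As ]) (sp : Spine Γ As Bs) →
    rename r (appSpine M sp) ≡ appSpine (rename r M) (renSp r sp)
  rename-appSpine r M done     = refl
  rename-appSpine r M (s ∷ sp) = trans (rename-appSpine r (app M (emb s)) sp)
    (cong (λ t → appSpine (app (rename r M) t) (renSp r sp)) (sym (emb-renNf r s)))

appSpine-cong : ∀ {Γ As Bs} {M M′ : Tm Γ [ As ]} → M =βη M′ → (sp : Spine Γ As Bs) →
  appSpine M sp =βη appSpine M′ sp
appSpine-cong e done     = e
appSpine-cong e (s ∷ sp) = appSpine-cong (cong-app e refl′) sp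

appSpine-snoc : ∀ {Γ As B Bs} (M : Tm Γ [ As ]) (sp : Spine Γ As (B ∷ Bs)) (s : Nf Γ B) →
  appSpine M (snoc sp s) ≡ app (appSpine M sp) (emb s)
appSpine-snoc M done     s = refl
appSpine-snoc M (t ∷ sp) s = appSpine-snoc (app M (emb t)) sp s

mutual
  η-expand-complete : ∀ {Γ As Bs} (x : Γ ∋ [ As ]) (sp : Spine Γ As Bs) →
    appSpine (var x) sp =βη emb (η-expand x sp)
  η-expand-complete {Bs = []}     x sp = refl′
  η-expand-complete {Bs = B ∷ Bs} x sp = trans′ (η _) (cong-lam (trans′
    (cong-app (≡→=βη (rename-appSpine there (var x) sp)) (varNf-complete here))
    (trans′ (≡→=βη (sym (appSpine-snoc (var (there x)) (renSp there sp) (varNf here))))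
            (η-expand-complete (there x) (extSp sp)))))

  varNf-complete : ∀ {Γ A} (x : Γ ∋ A) → var x =βη emb (varNf x)
  varNf-complete {A = [ As ]} x = η-expand-complete x done

-- σ performs, on syntax, the hereditary substitution of u for y.
data Agrees {Γ C Γ⁻} (y : Del Γ C Γ⁻) (u : Nf Γ⁻ C) : ∀ {B} → Γ ∋ B → Tm Γ⁻ B → Set where
  keep : ∀ {B} (z : Γ⁻ ∋ B) → Agrees y u (skip y z) (var z)
  hit  : ∀ {t} → t ≡ emb u → Agrees y u (deleted y) t

agrees-tl : ∀ {Γ C Γ⁻ B D} {y : Del Γ C Γ⁻} {u : Nf Γ⁻ C} {x : Γ ∋ B} {t : Tm Γ⁻ B} →
  Agrees y u x t → Agrees (tl {B = D} y) (wkNf u) (there x) (rename there t)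
agrees-tl (keep z)          = keep (there z)
agrees-tl {u = u} (hit e)   = hit (trans (cong (rename there) e) (sym (emb-renNf there u)))

agrees-single : ∀ {Γ C} (u : Nf Γ C) {B} (x : (C ∷ Γ) ∋ B) → Agrees hd u x (single (emb u) x)
agrees-single u here      = hit refl
agrees-single u (there x) = keep x

mutual
  hsub-complete : ∀ {Γ C Γ⁻ A} (y : Del Γ C Γ⁻) (σ : Sub Γ Γ⁻) (u : Nf Γ⁻ C) →
    (∀ {B} (x : Γ ∋ B) → Agrees y u x (σ x)) →
    (b : Nf Γ A) → subst-tm σ (emb b) =βη emb (hsub y b u)
  hsub-complete y σ u H (lam b)   = cong-lam (hsub-complete (tl y) (extS σ) (wkNf u) H′ b)
    where
    H′ : ∀ {B} (x : _ ∋ B) → Agrees (tl y) (wkNf u) x (extS σ x)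
    H′ here      = keep here
    H′ (there x) = agrees-tl (H x)
  hsub-complete y σ u H (ne z sp) = hsub-ne-complete y σ u H (H z) refl sp

  hsub-ne-complete : ∀ {Γ C Γ⁻ As} (y : Del Γ C Γ⁻) (σ : Sub Γ Γ⁻) (u : Nf Γ⁻ C) →
    (∀ {B} (x : Γ ∋ B) → Agrees y u x (σ x)) →
    {z : Γ ∋ [ As ]} {t : Tm Γ⁻ [ As ]} → Agrees y u z t → σ z ≡ t →
    (sp : Spine Γ As []) → subst-tm σ (appSpine (var z) sp) =βη emb (hsub y (ne z sp) u)
  hsub-ne-complete y σ u H (keep z) e sp =
    trans′ (hsubSpine-complete y σ u H (var (skip y z)) (var z) (≡→=βη e) sp)
           (≡→=βη (cong emb (sym (hsub-ne-skip y z sp u))))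
  hsub-ne-complete y σ u H (hit e′) e sp =
    trans′ (hsubSpine-complete y σ u H (var (deleted y)) (emb u) (≡→=βη (trans e e′)) sp)
    (trans′ (happ-complete u (hsubSp y sp u)) (≡→=βη (cong emb (sym (hsub-ne-deleted y sp u)))))

  hsubSpine-complete : ∀ {Γ C Γ⁻ As Bs} (y : Del Γ C Γ⁻) (σ : Sub Γ Γ⁻) (u : Nf Γ⁻ C) →
    (∀ {B} (x : Γ ∋ B) → Agrees y u x (σ x)) →
    (M : Tm Γ [ As ]) (M′ : Tm Γ⁻ [ As ]) → subst-tm σ M =βη M′ →
    (sp : Spine Γ As Bs) → subst-tm σ (appSpine M sp) =βη appSpine M′ (hsubSp y sp u)
  hsubSpine-complete y σ u H M M′ e done     = e
  hsubSpine-complete y σ u H M M′ e (s ∷ sp) =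
    hsubSpine-complete y σ u H (app M (emb s)) (app M′ (emb (hsub y s u))) (cong-app e (hsub-complete y σ u H s)) sp

  β-complete : ∀ {Γ A Bs} (b : Nf (A ∷ Γ) [ Bs ]) (n : Nf Γ A) → app (lam (emb b)) (emb n) =βη emb (hsub hd b n)
  β-complete b n = trans′ (β (emb b) (emb n)) (hsub-complete hd (single (emb n)) n (agrees-single n) b)

  happ-complete : ∀ {Γ As Bs} (v : Nf Γ [ As ]) (sp : Spine Γ As Bs) → appSpine (emb v) sp =βη emb (happ v sp)
  happ-complete v       done     = refl′
  happ-complete (lam b) (s ∷ sp) = trans′ (appSpine-cong (β-complete b s) sp) (happ-complete (hsub hd b s) sp)

nf-complete : ∀ {Γ A} (M : Tm Γ A) → M =βη emb (nf M)
nf-complete (var x)   = varNf-complete x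
nf-complete (lam M)   = cong-lam (nf-complete M)
nf-complete (app M N) = trans′ (cong-app (nf-complete M) (nf-complete N)) (happ₁-complete (nf M) (nf N))
  where
  happ₁-complete : ∀ {Γ A Bs} (m : Nf Γ [ A ∷ Bs ]) (n : Nf Γ A) → app (emb m) (emb n) =βη emb (happ₁ m n)
  happ₁-complete (lam b) n = β-complete b n

nfArgs : ∀ {Γ As} → Args Γ As → Spine Γ As []
nfArgs []       = done
nfArgs (M ∷ Ms) = nf M ∷ nfArgs Ms

nf-apps : ∀ {Γ As} (P : Tm Γ [ As ]) (Ms : Args Γ As) → nf (apps P Ms) ≡ happ (nf P) (nfArgs Ms)
nf-apps P []       = refl
nf-apps P (M ∷ Ms) = trans (nf-apps (app P M) Ms) (happ-happ₁ (nf P) (nf M) (nfArgs Ms))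
  where
  happ-happ₁ : ∀ {Γ A Bs} (m : Nf Γ [ A ∷ Bs ]) (n : Nf Γ A) (sp : Spine Γ Bs []) →
    happ (happ₁ m n) sp ≡ happ m (n ∷ sp)
  happ-happ₁ (lam b) n sp = refl

nf-apps-var : ∀ {Γ As} (v : Γ ∋ [ As ]) (Ms : Args Γ As) → nf (apps (var v) Ms) ≡ ne v (nfArgs Ms)
nf-apps-var v Ms = trans (nf-apps (var v) Ms) (happ-η-expand v done (nfArgs Ms))

∷-injective : ∀ {Γ A As Bs} {s s′ : Nf Γ A} {sp sp′ : Spine Γ As Bs} →
  (s ∷ sp) ≡ (s′ ∷ sp′) → s ≡ s′ × sp ≡ sp′
∷-injective refl = refl , refl

nfArgs-injective : ∀ {Γ As} (Ms Ns : Args Γ As) → nfArgs Ms ≡ nfArgs Ns → Ms ≈Args Ns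
nfArgs-injective []       []       e = []
nfArgs-injective (M ∷ Ms) (N ∷ Ns) e with ∷-injective e
... | nfM≡nfN , e′ =
  trans′ (nf-complete M) (trans′ (≡→=βη (cong emb nfM≡nfN)) (sym′ (nf-complete N)))
    ∷ nfArgs-injective Ms Ns e′

ne-injective : ∀ {Γ As Bs} {v : Γ ∋ [ As ]} {v′ : Γ ∋ [ Bs ]} {sp : Spine Γ As []} {sp′ : Spine Γ Bs []} →
  ne v sp ≡ ne v′ sp′ → Σ (As ≡ Bs) λ { refl → v ≡ v′ × sp ≡ sp′ }
ne-injective refl = refl , refl , refl

apps-var-injective : ∀ {Γ As Bs} (v : Γ ∋ [ As ]) (v′ : Γ ∋ [ Bs ]) (Ms : Args Γ As) (Ns : Args Γ Bs) →
  apps (var v) Ms =βη apps (var v′) Ns → SameHeadArgs v v′ Ms Ns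
apps-var-injective v v′ Ms Ns e
  with ne-injective (trans (sym (nf-apps-var v Ms)) (trans (nf-sound e) (nf-apps-var v′ Ns)))
... | refl , v≡v′ , sp≡sp′ = refl , v≡v′ , nfArgs-injective Ms Ns sp≡sp′

extΞ-inl : ∀ Ξ {Γ Δ A} (ρ : Sub Γ Δ) (d : Ξ ∋ A) → extΞ Ξ ρ (inl {Ξ} {Γ} d) ≡ var (inl {Ξ} {Δ} d)
extΞ-inl (B ∷ Ξ) ρ here      = refl
extΞ-inl (B ∷ Ξ) ρ (there d) = cong (rename there) (extΞ-inl Ξ ρ d)

extΞ-inr : ∀ Ξ {Γ Δ A} (ρ : Sub Γ Δ) (x : Γ ∋ A) → extΞ Ξ ρ (inr Ξ x) ≡ wkΞ Ξ (ρ x)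
extΞ-inr []      ρ x = sym (rename-id (ρ x))
extΞ-inr (B ∷ Ξ) ρ x = trans (cong (rename there) (extΞ-inr Ξ ρ x)) (rename-comp (inr Ξ) there (ρ x))

data Split (Ξ : Ctx) {Γ : Ctx} : ∀ {A} → (Ξ ++ Γ) ∋ A → Set where
  left  : ∀ {A} (d : Ξ ∋ A) → Split Ξ (inl {Ξ} {Γ} d)
  right : ∀ {A} (x : Γ ∋ A) → Split Ξ (inr Ξ x)

split : ∀ Ξ {Γ A} (v : (Ξ ++ Γ) ∋ A) → Split Ξ v
split []      v         = right v
split (B ∷ Ξ) here      = left here
split (B ∷ Ξ) (there v) with split Ξ v
... | left d  = left (there d)
... | right x = right x

there-injective : ∀ {Θ B C} {x y : Θ ∋ C} → there {B = B} x ≡ there y → x ≡ y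
there-injective refl = refl

inl-injective : ∀ {Ξ Δ A} {d d′ : Ξ ∋ A} → inl {Ξ} {Δ} d ≡ inl d′ → d ≡ d′
inl-injective {d = here}    {here}     e  = refl
inl-injective {d = there d} {there d′} e  = cong there (inl-injective (there-injective e))
inl-injective {d = here}    {there d′} ()
inl-injective {d = there d} {here}     ()

SameHeadArgs-inr : ∀ Ξ {Γ Θ As Bs} {x : Γ ∋ [ As ]} {x′ : Γ ∋ [ Bs ]} {Ms : Args Θ As} {Ns : Args Θ Bs} →
  SameHeadArgs x x′ Ms Ns → SameHeadArgs (inr Ξ x) (inr Ξ x′) Ms Ns
SameHeadArgs-inr Ξ (refl , x≡x′ , Ms≈Ns) = refl , cong (inr Ξ) x≡x′ , Ms≈Ns

apps-=βη-heads : ∀ {Θ As Bs} {P P′ : Tm Θ [ As ]} {Q Q′ : Tm Θ [ Bs ]} (Ms : Args Θ As) (Ns : Args Θ Bs) →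
  P ≡ P′ → Q ≡ Q′ → apps P Ms =βη apps Q Ns → apps P′ Ms =βη apps Q′ Ns
apps-=βη-heads Ms Ns refl refl e = e

lemmaL : ∀ {Γ Δ : Ctx} (ρ : Sub Γ Δ) →
    (∀ (Ξ : Ctx) → CondI ρ Ξ × CondII ρ Ξ) →
    IsAtomicReduction ρ
lemmaL {Γ} {Δ} ρ hyp Ξ a b = atomic (split Ξ a) (split Ξ b)
  where
  atomic : ∀ {As Bs} {a : (Ξ ++ Γ) ∋ [ As ]} {b : (Ξ ++ Γ) ∋ [ Bs ]} → Split Ξ a → Split Ξ b →
    (Ms : Args (Ξ ++ Δ) As) (Ns : Args (Ξ ++ Δ) Bs) →
    apps (extΞ Ξ ρ a) Ms =βη apps (extΞ Ξ ρ b) Ns → SameHeadArgs a b Ms Ns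
  atomic (left d) (left d′) Ms Ns e
    with apps-var-injective (inl d) (inl d′) Ms Ns (apps-=βη-heads Ms Ns (extΞ-inl Ξ ρ d) (extΞ-inl Ξ ρ d′) e)
  ... | refl , d≡d′ , Ms≈Ns = refl , cong inl (inl-injective d≡d′) , Ms≈Ns
  atomic (left d) (right x) Ms Ns e =
    ⊥-elim (proj₂ (hyp Ξ) x d Ns Ms (sym′ (apps-=βη-heads Ms Ns (extΞ-inl Ξ ρ d) (extΞ-inr Ξ ρ x) e)))
  atomic (right x) (left d) Ms Ns e =
    ⊥-elim (proj₂ (hyp Ξ) x d Ms Ns (apps-=βη-heads Ms Ns (extΞ-inr Ξ ρ x) (extΞ-inl Ξ ρ d) e))
  atomic (right x) (right x′) Ms Ns e =
    SameHeadArgs-inr Ξ (proj₁ (hyp Ξ) x x′ Ms Ns (apps-=βη-heads Ms Ns (extΞ-inr Ξ ρ x) (extΞ-inr Ξ ρ x′) e))
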